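{- Let $\Psi$ be a DQBF over variables $V$ and $V'\subseteq V_\forall$ a subset of its universal variables. If $\Psi$ is satisfiable, then $\mathrm{abs}(\Psi,V')$ is satisfiable.
   Context: A DQBF over a finite set $V=\{x_1,\dots,x_n,y_1,\dots,y_m\}$ of Boolean variables has the form $\forall x_1\ldots\forall x_n\exists y_1(D_{y_1})\ldots\exists y_m(D_{y_m}):\varphi$, where $D_{y_i}\subseteq\{x_1,\dots,x_n\}$ is the dependency set of $y_i$ and $\varphi$ is a CNF over $V$. The prefix is treated as a set $\Pi$. $V_\exists$ and $V_\forall$ denote the existential and universal variables. A Skolem function is a family $(s_y)_{y\in V_\exists}$ with $s_y:\mathcal{A}(D_y)\to\{0,1\}$, where $\mathcal{A}(X)$ is the set of assignments $X\to\{0,1\}$, such that substituting $s_y$ for each $y$ makes $\varphi$ a tautology. The DQBF is satisfiable iff a Skolem function exists. Abstraction: $\mathrm{abs}(\Pi:\varphi,V')$ is the DQBF with the same matrix $\varphi$ in which every $v\in V'$ is removed as a universal variable, removed from all dependency sets, and instead quantified existentially with empty dependency set, $\exists v(\emptyset)$. -}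

module Defs where

open import Data.Nat using (ℕ)
open import Data.Fin using (Fin)
open import Data.Fin.Subset using (Subset; _∈_; _∉_; _⊆_; ⊥; _∩_; ∁)
open import Data.Fin.Subset.Properties using (_∈?_)
open import Data.Bool using (Bool)
open import Data.Product using (_×_; Σ; proj₁; proj₂)
open import Data.List using (List)
open import Data.List.Relation.Unary.All using (All)
open import Data.List.Relation.Unary.Any using (Any)
open import Relation.Binary.PropositionalEquality using (_≡_)
open import Relation.Nullary using (yes; no)

data Quant (n : ℕ) : Set where
  univ  : Quant n
  exist : Subset n → Quant n

-- A literal: a variable together with a polarity (true = positive literal).
Literal : ℕ → Set
Literal n = Fin n × Bool

Clause : ℕ → Set
Clause n = List (Literal n)

CNF : ℕ → Set
CNF n = List (Clause n)

-- A DQBF  Π : φ  over variables Fin n: the prefix (treated as a set) assigns to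
-- every variable its quantifier; φ is the matrix.
record DQBF (n : ℕ) : Set where
  constructor mkDQBF
  field
    prefix : Fin n → Quant n
    matrix : CNF n
open DQBF public

IsUniv : ∀ {n} → DQBF n → Fin n → Set
IsUniv Ψ v = prefix Ψ v ≡ univ

Universals : ∀ {n} → DQBF n → Fin n → Set
Universals = IsUniv

WellFormed : ∀ {n} → DQBF n → Set
WellFormed Ψ = ∀ y D → prefix Ψ y ≡ exist D → ∀ x → x ∈ D → IsUniv Ψ x

Asg : ∀ {n} → Subset n → Set
Asg {n} X = (x : Fin n) → x ∈ X → Bool

-- dependency set of a quantifier (junk ⊥ for universals, unused)
depsOf : ∀ {n} → Quant n → Subset n
depsOf univ      = ⊥
depsOf (exist D) = D

-- A candidate Skolem function: for each existential y a function 𝒜(D_y) → {0,1}.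
-- (Components at universal variables are irrelevant and never used.)
SkolemCandidate : ∀ {n} → DQBF n → Set
SkolemCandidate {n} Ψ = (y : Fin n) → Asg (depsOf (prefix Ψ y)) → Bool

valQ : ∀ {n} (q : Quant n) → Bool → (Fin n → Bool) → (Asg (depsOf q) → Bool) → Bool
valQ univ      αv α s = αv
valQ (exist D) αv α s = s (λ x _ → α x)

extend : ∀ {n} (Ψ : DQBF n) → SkolemCandidate Ψ → (Fin n → Bool) → Fin n → Bool
extend Ψ s α v = valQ (prefix Ψ v) (α v) α (s v)

LitSat : ∀ {n} → (Fin n → Bool) → Literal n → Set
LitSat β l = β (proj₁ l) ≡ proj₂ l

ClauseSat : ∀ {n} → (Fin n → Bool) → Clause n → Set
ClauseSat β c = Any (LitSat β) c

CNFSat : ∀ {n} → (Fin n → Bool) → CNF n → Set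
CNFSat β φ = All (ClauseSat β) φ

-- s is a Skolem function: substituting it makes φ a tautology, i.e. φ holds for
-- every assignment of the universal variables (α's values on existential
-- variables are ignored by `extend`).
IsSkolem : ∀ {n} (Ψ : DQBF n) → SkolemCandidate Ψ → Set
IsSkolem {n} Ψ s = (α : Fin n → Bool) → CNFSat (extend Ψ s α) (matrix Ψ)

Satisfiable : ∀ {n} → DQBF n → Set
Satisfiable Ψ = Σ (SkolemCandidate Ψ) (IsSkolem Ψ)

absQ : ∀ {n} → Subset n → Fin n → Quant n → Quant n
absQ V' v q with v ∈? V'
... | yes _ = exist ⊥
absQ V' v univ      | no _ = univ
absQ V' v (exist D) | no _ = exist (D ∩ ∁ V')

abs : ∀ {n} → DQBF n → Subset n → DQBF n
abs Ψ V' = mkDQBF (λ v → absQ V' v (prefix Ψ v)) (matrix Ψ)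

{-# OPTIONS --safe #-}
module Submission where

open import Defs
open import Data.Nat using (ℕ)
open import Data.Fin using (Fin)
open import Data.Fin.Subset using (Subset; _∈_; _∉_; _∩_; ∁)
open import Data.Fin.Subset.Properties using (_∈?_; x∈p∩q⁺; x∉p⇒x∈∁p)
open import Data.Bool using (Bool; false)
open import Data.Product using (_,_; proj₁)
open import Data.List.Relation.Unary.All as All using ()
open import Data.List.Relation.Unary.Any as Any using ()
open import Function using (_∘_)
open import Relation.Binary.PropositionalEquality using (_≡_; refl; trans; _≗_)
open import Relation.Nullary using (yes; no)

-- The abstracted variables are pinned to a constant b. A Skolem function of Ψ then
-- yields one of abs(Ψ, V'): the new variables ∃v(∅) take the constant value b, and
-- every other existential feeds b for the removed dependencies into its old
-- Skolem function. Under every universal assignment α, the resulting full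
-- assignment coincides with that of Ψ under α pinned to b on V', which
-- satisfies the matrix.

CNFSat-resp-≗ : ∀ {n} {β γ : Fin n → Bool} → β ≗ γ → (φ : CNF n) → CNFSat γ φ → CNFSat β φ
CNFSat-resp-≗ β≗γ _ = All.map (Any.map λ {l} γl → trans (β≗γ (proj₁ l)) γl)

module _ {n : ℕ} (V' : Subset n) (b : Bool) where

  -- Both pin and pinAsg go through pinAt, so pinAsg D (λ x _ → α x) and pin α
  -- agree definitionally and extend-pinnedSkolem holds by refl.
  pinAt : (x : Fin n) → (x ∉ V' → Bool) → Bool
  pinAt x f with x ∈? V'
  ... | yes _    = b
  ... | no x∉V' = f x∉V'

  pin : (Fin n → Bool) → Fin n → Bool
  pin α x = pinAt x (λ _ → α x)

  pinAsg : (D : Subset n) → Asg (D ∩ ∁ V') → Asg D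
  pinAsg D β x x∈D = pinAt x (λ x∉V' → β x (x∈p∩q⁺ (x∈D , x∉p⇒x∈∁p x∉V')))

  pinnedComponent : (v : Fin n) (q : Quant n) →
                    (Asg (depsOf q) → Bool) → Asg (depsOf (absQ V' v q)) → Bool
  pinnedComponent v q t with v ∈? V'
  ... | yes _ = λ _ → b
  pinnedComponent v univ      t | no _ = λ _ → b
  pinnedComponent v (exist D) t | no _ = t ∘ pinAsg D

  module _ (Ψ : DQBF n) (V'⊆V∀ : ∀ v → v ∈ V' → IsUniv Ψ v) (s : SkolemCandidate Ψ) where

    pinnedSkolem : SkolemCandidate (abs Ψ V')
    pinnedSkolem y = pinnedComponent y (prefix Ψ y) (s y)

    extend-pinnedSkolem : ∀ α → extend (abs Ψ V') pinnedSkolem α ≗ extend Ψ s (pin α)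
    extend-pinnedSkolem α v with v ∈? V'
    ... | yes v∈V' with prefix Ψ v | V'⊆V∀ v v∈V' | s v
    ...   | .univ | refl | _ = refl
    extend-pinnedSkolem α v | no _ with prefix Ψ v | s v
    ... | univ    | _ = refl
    ... | exist D | _ = refl

    pinnedSkolem-isSkolem : IsSkolem Ψ s → IsSkolem (abs Ψ V') pinnedSkolem
    pinnedSkolem-isSkolem s-ok α =
      CNFSat-resp-≗ (extend-pinnedSkolem α) (matrix Ψ) (s-ok (pin α))

mainTheorem6 : ∀ {n} (Ψ : DQBF n) → WellFormed Ψ → (V' : Subset n) → (∀ v → v ∈ V' → IsUniv Ψ v) → Satisfiable Ψ → Satisfiable (abs Ψ V')
mainTheorem6 Ψ _ V' V'⊆V∀ (s , s-ok) =
  pinnedSkolem V' false Ψ V'⊆V∀ s , pinnedSkolem-isSkolem V' false Ψ V'⊆V∀ s s-ok
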